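{- Let $(S,=,\#;\tau)$ be a co-quasiordered set with apartness. Then: (i) $\kappa_\tau=\tau\cup\tau^{ -1}$ is a co-equivalence on $S$; (ii) $(S/\kappa_\tau^c,=,\#)$ is a set with apartness, where $x\kappa_\tau^c=y\kappa_\tau^c\iff(x,y)\in{\sim}\kappa_\tau$ and $x\kappa_\tau^c\#y\kappa_\tau^c\iff(x,y)\in\kappa_\tau$; (iii) $(S/\kappa_\tau^c,=,\#;\Upsilon_\tau)$ is a co-ordered set with apartness, where $(x\kappa_\tau^c,y\kappa_\tau^c)\in\Upsilon_\tau\iff(x,y)\in\tau$; (iv) the quotient map $\pi_\tau:S\to S/\kappa_\tau^c$, $\pi_\tau(x)=x\kappa_\tau^c$, is an isotone and reverse isotone se-surjection.
   Context: Constructive (Bishop-style) setting. A set with apartness: inhabited set with equality $=$ (an equivalence) and $\#$ with $\neg(x\#x)$, $x\#y\Rightarrow y\#x$, $x\#z\Rightarrow\forall y(x\#y\vee y\#z)$, extensional w.r.t. $=$; $S\times S$ has apartness $(s,t)\#(u,v)\iff s\#u\vee t\#v$. A relation $\alpha$ is strongly irreflexive if $(x,y)\in\alpha\Rightarrow x\#y$; co-transitive if $(x,y)\in\alpha\Rightarrow\forall z((x,z)\in\alpha\vee(z,y)\in\alpha)$; co-antisymmetric if $x\#y\Rightarrow(x,y)\in\alpha\vee(y,x)\in\alpha$. Co-quasiorder: strongly irreflexive and co-transitive; co-equivalence: symmetric co-quasiorder; co-order: co-antisymmetric co-quasiorder. A co-(quasi)ordered set with apartness is a set with apartness equipped with a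 co-(quasi)order. ${\sim}\alpha=\{(x,y):\forall(a,b)\in\alpha\,((x,y)\#(a,b))\}$; for a co-quasiorder $\kappa$, $\kappa^c$ denotes ${\sim}\kappa$ (which equals the logical complement). A map $g$ is isotone if $(x,y)\in\tau\Rightarrow(g(x),g(y))\in\Upsilon_\tau$, reverse isotone if the converse holds; an se-surjection is a surjective mapping with $g(x)\#g(y)\Rightarrow x\#y$. -}

module Defs where

open import Level using (Level; _⊔_)
open import Data.Product using (_×_; ∃)
open import Data.Sum using (_⊎_)
open import Relation.Nullary using (¬_)
open import Relation.Binary.Core using (Rel)
open import Relation.Binary.Structures using (IsEquivalence)

private variable
  a b ℓ₁ ℓ₂ ℓ₃ ℓ₄ ℓ ℓ' : Level

record IsApartness {A : Set a} (_≈_ : Rel A ℓ₁) (_#_ : Rel A ℓ₂)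
       : Set (a ⊔ ℓ₁ ⊔ ℓ₂) where
  field
    inhabited     : A
    isEquivalence : IsEquivalence _≈_
    #-irrefl      : ∀ x → ¬ (x # x)
    #-sym         : ∀ {x y} → x # y → y # x
    #-cotrans     : ∀ {x z} → x # z → ∀ y → (x # y) ⊎ (y # z)
    #-ext         : ∀ {x x' y y'} → x ≈ x' → y ≈ y' → x # y → x' # y'

module _ {A : Set a} (_#_ : Rel A ℓ₂) where

  StronglyIrreflexive : Rel A ℓ → Set (a ⊔ ℓ₂ ⊔ ℓ)
  StronglyIrreflexive α = ∀ {x y} → α x y → x # y

  CoTransitive : Rel A ℓ → Set (a ⊔ ℓ)
  CoTransitive α = ∀ {x y} → α x y → ∀ z → α x z ⊎ α z y

  CoAntisymmetric : Rel A ℓ → Set (a ⊔ ℓ₂ ⊔ ℓ)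
  CoAntisymmetric α = ∀ {x y} → x # y → α x y ⊎ α y x

  IsCoQuasiorder : Rel A ℓ → Set (a ⊔ ℓ₂ ⊔ ℓ)
  IsCoQuasiorder α = StronglyIrreflexive α × CoTransitive α

  IsCoEquivalence : Rel A ℓ → Set (a ⊔ ℓ₂ ⊔ ℓ)
  IsCoEquivalence α = (∀ {x y} → α x y → α y x) × IsCoQuasiorder α

  IsCoOrder : Rel A ℓ → Set (a ⊔ ℓ₂ ⊔ ℓ)
  IsCoOrder α = CoAntisymmetric α × IsCoQuasiorder α

  -- ∼α = {(x,y) : ∀ (a,b) ∈ α, (x,y) # (a,b)}
  ∼_ : Rel A ℓ → Rel A (a ⊔ ℓ₂ ⊔ ℓ)
  (∼ α) x y = ∀ u v → α u v → (x # u) ⊎ (y # v)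

κ : {A : Set a} → Rel A ℓ → Rel A ℓ
κ τ x y = τ x y ⊎ τ y x

Respects≈ : {A : Set a} → Rel A ℓ₁ → Rel A ℓ → Set (a ⊔ ℓ₁ ⊔ ℓ)
Respects≈ _≈_ α = ∀ {x x' y y'} → x ≈ x' → y ≈ y' → α x y → α x' y'

module _ {A : Set a} {B : Set b} where

  IsMapping : Rel A ℓ₁ → Rel B ℓ₃ → (A → B) → Set (a ⊔ ℓ₁ ⊔ ℓ₃)
  IsMapping _≈₁_ _≈₂_ g = ∀ {x y} → x ≈₁ y → g x ≈₂ g y

  IsSurjective : Rel B ℓ₃ → (A → B) → Set (a ⊔ b ⊔ ℓ₃)
  IsSurjective _≈₂_ g = ∀ y → ∃ λ x → g x ≈₂ y

  IsSeSurjection : Rel A ℓ₁ → Rel A ℓ₂ → Rel B ℓ₃ → Rel B ℓ₄ → (A → B)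
                   → Set (a ⊔ b ⊔ ℓ₁ ⊔ ℓ₂ ⊔ ℓ₃ ⊔ ℓ₄)
  IsSeSurjection _≈₁_ _#₁_ _≈₂_ _#₂_ g =
    IsMapping _≈₁_ _≈₂_ g × IsSurjective _≈₂_ g
    × (∀ {x y} → g x #₂ g y → x #₁ y)

  IsIsotone : Rel A ℓ → Rel B ℓ' → (A → B) → Set (a ⊔ ℓ ⊔ ℓ')
  IsIsotone τ Υ g = ∀ {x y} → τ x y → Υ (g x) (g y)

  IsReverseIsotone : Rel A ℓ → Rel B ℓ' → (A → B) → Set (a ⊔ ℓ ⊔ ℓ')
  IsReverseIsotone τ Υ g = ∀ {x y} → Υ (g x) (g y) → τ x y

{-# OPTIONS --safe #-}
module Submission where

-- A pair in ∼α is never in α, since that would make one of its components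
-- apart from itself. With co-transitivity this shows that a co-transitive
-- relation contained in α and in α⁻¹ is extensional for the equality ∼α, and
-- that ∼α is an equivalence when α is a co-equivalence. Applied to α = κ_τ this
-- gives the quotient by κ_τ^c, which is modelled on S itself, so that π_τ is
-- the identity.

open import Defs
open import Level using (Level)
open import Function using (id)
open import Data.Product using (_×_; _,_)
open import Data.Sum using (inj₁; inj₂; [_,_]; swap)
open import Data.Empty using (⊥-elim)
open import Relation.Nullary using (¬_)
open import Relation.Binary.Core using (Rel)
open import Relation.Binary.Structures using (IsEquivalence)

private variable
  a ℓ₁ ℓ₂ ℓ ℓ' : Level

κ-sym : {S : Set a} {τ : Rel S ℓ} → ∀ {x y} → κ τ x y → κ τ y x
κ-sym = swap

module _ {S : Set a} {_#_ : Rel S ℓ₂} where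

  κ-stronglyIrreflexive : {τ : Rel S ℓ} → (∀ {x y} → x # y → y # x)
                        → StronglyIrreflexive _#_ τ → StronglyIrreflexive _#_ (κ τ)
  κ-stronglyIrreflexive #-sym τ-sirr (inj₁ t) = τ-sirr t
  κ-stronglyIrreflexive #-sym τ-sirr (inj₂ t) = #-sym (τ-sirr t)

  κ-coTransitive : {τ : Rel S ℓ} → CoTransitive _#_ τ → CoTransitive _#_ (κ τ)
  κ-coTransitive τ-cot (inj₁ t) z with τ-cot t z
  ... | inj₁ p = inj₁ (inj₁ p)
  ... | inj₂ p = inj₂ (inj₁ p)
  κ-coTransitive τ-cot (inj₂ t) z with τ-cot t z
  ... | inj₁ p = inj₂ (inj₂ p)
  ... | inj₂ p = inj₁ (inj₂ p)

  κ-isCoEquivalence : {τ : Rel S ℓ} → (∀ {x y} → x # y → y # x)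
                    → IsCoQuasiorder _#_ τ → IsCoEquivalence _#_ (κ τ)
  κ-isCoEquivalence {τ = τ} #-sym (τ-sirr , τ-cot) =
    κ-sym {τ = τ} , κ-stronglyIrreflexive #-sym τ-sirr , κ-coTransitive τ-cot

  ∼-sym : {α : Rel S ℓ} → (∀ {x y} → α x y → α y x)
        → ∀ {x y} → (∼_ _#_ α) x y → (∼_ _#_ α) y x
  ∼-sym α-sym e u v p = swap (e v u (α-sym p))

  module _ (#-irrefl : ∀ x → ¬ (x # x)) where

    ∼⇒¬ : {α : Rel S ℓ} → ∀ {x y} → (∼_ _#_ α) x y → ¬ α x y
    ∼⇒¬ {x = x} {y} e p with e x y p
    ... | inj₁ x#x = #-irrefl x x#x
    ... | inj₂ y#y = #-irrefl y y#y

    ∼-trans : {α : Rel S ℓ} → CoTransitive _#_ α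
            → ∀ {x y z} → (∼_ _#_ α) x y → (∼_ _#_ α) y z → (∼_ _#_ α) x z
    ∼-trans α-cot {y = y} e f u v p with α-cot p y
    ... | inj₁ uy = [ inj₁ , (λ y#y → ⊥-elim (#-irrefl y y#y)) ] (e u y uy)
    ... | inj₂ yv = [ (λ y#y → ⊥-elim (#-irrefl y y#y)) , inj₂ ] (f y v yv)

    coTransitive-respects-∼ : {α : Rel S ℓ} {β : Rel S ℓ'}
                            → (∀ {x y} → β x y → α x y) → (∀ {x y} → β x y → α y x)
                            → CoTransitive _#_ β → Respects≈ (∼_ _#_ α) β
    coTransitive-respects-∼ β⊆α β⊆α⁻¹ β-cot {x' = x'} {y' = y'} e f b with β-cot b x'
    ... | inj₁ xx' = ⊥-elim (∼⇒¬ e (β⊆α xx'))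
    ... | inj₂ x'y with β-cot x'y y'
    ...   | inj₁ x'y' = x'y'
    ...   | inj₂ y'y = ⊥-elim (∼⇒¬ f (β⊆α⁻¹ y'y))

  module _ {_≈_ : Rel S ℓ₁} (ap : IsApartness _≈_ _#_) where
    open IsApartness ap
    open IsEquivalence isEquivalence using (refl)

    ≈⇒∼ : {α : Rel S ℓ} → StronglyIrreflexive _#_ α
        → ∀ {x y} → x ≈ y → (∼_ _#_ α) x y
    ≈⇒∼ α-sirr {x} x≈y u v p with #-cotrans (α-sirr p) x
    ... | inj₁ u#x = inj₁ (#-sym u#x)
    ... | inj₂ x#v = inj₂ (#-ext x≈y refl x#v)

    quotient-isApartness : {α : Rel S ℓ} → IsCoEquivalence _#_ α
                         → IsApartness (∼_ _#_ α) α
    quotient-isApartness (α-sym , α-sirr , α-cot) = record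
      { inhabited     = inhabited
      ; isEquivalence = record
        { refl  = ≈⇒∼ α-sirr refl
        ; sym   = ∼-sym α-sym
        ; trans = ∼-trans #-irrefl α-cot
        }
      ; #-irrefl      = λ x p → #-irrefl x (α-sirr p)
      ; #-sym         = α-sym
      ; #-cotrans     = α-cot
      ; #-ext         = coTransitive-respects-∼ #-irrefl id α-sym α-cot
      }

lemma15 : ∀ {a ℓ₁ ℓ₂ ℓ : Level} {S : Set a}
            (_≈_ : Rel S ℓ₁) (_#_ : Rel S ℓ₂) (τ : Rel S ℓ)
          → IsApartness _≈_ _#_
          → IsCoQuasiorder _#_ τ
          → IsCoEquivalence _#_ (κ τ)
            × IsApartness (∼_ _#_ (κ τ)) (κ τ)
            × (Respects≈ (∼_ _#_ (κ τ)) τ × IsCoOrder (κ τ) τ)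
            × (IsIsotone τ τ id × IsReverseIsotone τ τ id
               × IsSeSurjection _≈_ _#_ (∼_ _#_ (κ τ)) (κ τ) id)
lemma15 _≈_ _#_ τ ap τ-coQuasi@(τ-sirr , τ-cot) =
  κτ-coEq ,
  quotient-isApartness ap κτ-coEq ,
  (coTransitive-respects-∼ #-irrefl inj₁ inj₂ τ-cot , id , inj₁ , τ-cot) ,
  (id , id , ≈⇒∼ ap κτ-sirr , (λ y → y , ≈⇒∼ ap κτ-sirr refl) , κτ-sirr)
  where
  open IsApartness ap using (#-irrefl; #-sym; isEquivalence)
  open IsEquivalence isEquivalence using (refl)

  κτ-coEq : IsCoEquivalence _#_ (κ τ)
  κτ-coEq = κ-isCoEquivalence #-sym τ-coQuasi

  κτ-sirr : StronglyIrreflexive _#_ (κ τ)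
  κτ-sirr = κ-stronglyIrreflexive {τ = τ} #-sym τ-sirr
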